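{- Let $\Theta\vdash P::\Gamma$ be derivable in CHOP. Then $\cdot\vdash[\![P]\!]::[\![\Theta]\!],[\![\Gamma]\!]$ is derivable in CP.
   Context: CHOP (Classical Higher-Order Processes). Channel names $x,y,z,\dots$; process variables $p,q,r$; parameter labels $l$; type variables $X$. A parameter record $\rho=\{l_1=x_1,\dots,l_k=x_k\}$ maps distinct labels to channels. Processes: $x[y].(P\mid Q)\mid x(y).P\mid x[\mathsf{inl}].P\mid x[\mathsf{inr}].P\mid x.\mathsf{case}(P,Q)\mid ?x[y].P\mid !x(y).P\mid x[A].P\mid x(X).P\mid x[\lambda\rho.P]$ (send an abstraction, which binds the image of $\rho$, required to be exactly the free channels of $P$) $\mid x(p).P$ (receive abstraction into $p$) $\mid p\langle\rho\rangle$ (run) $\mid x[\,]\mid x().P\mid x.\mathsf{case}()\mid x\leftrightarrow^A y\mid(\nu x^Ay)(P\mid Q)\mid\mathsf{let}\ p=\lambda\rho.Q\ \mathsf{in}\ P$ (explicit substitution). In $x[y].(P\mid Q)$, $x(y).P$, $?x[y].P$, $!x(y).P$, $y$ is bound in $P$. Session types: $A\otimes B\mid A⅋B\mid A\oplus B\mid A\&B\mid0\mid\top\mid1\mid\bot\mid ?A\mid !A\mid\exists X.A\mid\forall X.A\mid X\mid X^\perp\mid\mathsf{send}(\Gamma)\mid\mathsf{recv}(\Gamma)$; a process type $\Gamma=s_1:A_1,\dots,s_n:A_n$ maps distinct keys (labels or channels) to types, order irrelevant. Duality $A^\perp$ is the standard linear-logic duality ($\otimes/⅋$, $\oplus/\&$,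 $0/\top$, $1/\bot$, $?/!$, $\exists/\forall$, $X/X^\perp$ swapped, e.g. $(A\otimes B)^\perp=A^\perp⅋B^\perp$, $(?A)^\perp=!(A^\perp)$) extended by $\mathsf{send}(\Gamma)^\perp=\mathsf{recv}(\Gamma)$ and $\mathsf{recv}(\Gamma)^\perp=\mathsf{send}(\Gamma)$. $\Gamma\rho$ renames labels via $\rho$; $?\Gamma$ means all types in $\Gamma$ are of form $?A$. A process environment $\Theta=p_1:\Gamma_1,\dots,p_n:\Gamma_n$ (distinct variables); $\cdot$ empty. CHOP typing rules for $\Theta\vdash P::\Gamma$: (Axiom) $\cdot\vdash x\leftrightarrow^A y::x:A^\perp,y:A$. (Cut) $\Theta\vdash P::\Gamma,x:A$, $\Theta'\vdash Q::\Delta,y:A^\perp$ give $\Theta,\Theta'\vdash(\nu x^Ay)(P\mid Q)::\Gamma,\Delta$. ($\otimes$) $\Theta\vdash P::\Gamma,y:A$, $\Theta'\vdash Q::\Delta,x:B$ give $\Theta,\Theta'\vdash x[y].(P\mid Q)::\Gamma,\Delta,x:A\otimes B$. ($⅋$) $\Theta\vdash P::\Gamma,y:A,x:B$ gives $\Theta\vdash x(y).P::\Gamma,x:A⅋B$. ($\oplus_{1,2}$) $\Theta\vdash P::\Gamma,x:A$ (resp. $B$) gives $\Theta\vdash x[\mathsf{inl}].P$ (resp. $x[\mathsf{inr}].P$) $::\Gamma,x:A\oplus B$. ($\&$) $\Theta\vdash P::\Gamma,x:A$, $\Theta\vdash Q::\Gamma,x:B$ give $\Theta\vdash x.\mathsf{case}(P,Q)::\Gamma,x:A\&B$.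 ($?$) $\Theta\vdash P::\Gamma,y:A$ gives $\Theta\vdash ?x[y].P::\Gamma,x:?A$. ($!$) $\cdot\vdash P::?\Gamma,y:A$ gives $\cdot\vdash !x(y).P::?\Gamma,x:!A$. ($\exists$) $\Theta\vdash P::\Gamma,x:B\{A/X\}$ gives $\Theta\vdash x[A].P::\Gamma,x:\exists X.B$. ($\forall$) $\Theta\vdash P::\Gamma,x:B$, $X$ not free in $\Theta,\Gamma$, gives $\Theta\vdash x(X).P::\Gamma,x:\forall X.B$. (Weaken) $\Theta\vdash P::\Gamma$ gives $\Theta\vdash P::\Gamma,x:?A$. (Contract) $\Theta\vdash P::\Gamma,y:?A,z:?A$ gives $\Theta\vdash P\{x/y,x/z\}::\Gamma,x:?A$. ($1$) $\cdot\vdash x[\,]::x:1$. ($\bot$) $\Theta\vdash P::\Gamma$ gives $\Theta\vdash x().P::\Gamma,x:\bot$. ($\top$) $\Theta\vdash x.\mathsf{case}()::\Gamma,x:\top$. (Id) $p:\Gamma\vdash p\langle\rho\rangle::\Gamma\rho$. (Chop) $\Theta\vdash P::\Delta\rho$, $\Theta',p:\Delta\vdash Q::\Gamma$ give $\Theta,\Theta'\vdash\mathsf{let}\ p=\lambda\rho.P\ \mathsf{in}\ Q::\Gamma$. ($\mathsf{send}$) $\Theta\vdash P::\Gamma\rho$ gives $\Theta\vdash x[\lambda\rho.P]::x:\mathsf{send}(\Gamma)$. ($\mathsf{recv}$) $\Theta,p:\Delta\vdash P::\Gamma$ gives $\Theta\vdash x(p).P::\Gamma,x:\mathsf{recv}(\Delta)$.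 CP is the fragment of CHOP without the types $\mathsf{send}(\Gamma),\mathsf{recv}(\Gamma)$, without the terms $x[\lambda\rho.P]$, $x(p).P$, $p\langle\rho\rangle$ and explicit substitutions, whose typing rules are those above except Id, Chop, $\mathsf{send}$, $\mathsf{recv}$, with the process environment removed (always empty). In CP, free output $x[y].P$ abbreviates $x[z].(y\leftrightarrow z\mid P)$ ($z$ fresh). Type translation: $[\![\mathsf{send}(\Delta)]\!]=([\![\Delta]\!])^\perp\otimes 1$; $[\![\mathsf{recv}(\Delta)]\!]=[\![\Delta]\!]⅋\bot$; for a label-keyed $\Delta=(l_1:A_1,\dots,l_n:A_n)$ with labels in lexicographic order, $[\![\Delta]\!]=[\![A_1^\perp]\!]\otimes\cdots\otimes[\![A_n^\perp]\!]\otimes 1$; all other connectives, units, atoms and quantifiers are translated homomorphically ($[\![A\otimes B]\!]=[\![A]\!]\otimes[\![B]\!]$, $[\![X]\!]=X$, $[\![?A]\!]=?[\![A]\!]$, $[\![\exists X.A]\!]=\exists X.[\![A]\!]$, etc.). For channel-keyed $\Gamma$, $[\![\Gamma]\!]$ translates each type pointwise. For process environments: $[\![\cdot]\!]=\cdot$ and $[\![\Theta,p:\Delta]\!]=[\![\Theta]\!],x^p:[\![\Delta]\!]$, where $\{x^p\}$ is a family of channel names, one per process variable $p$, not otherwise used. Process translation $[\![\cdot]\!]$, defined on CHOP typing derivations (records $\rho=\{l_1=z_1,\dots,l_k=z_k\}$ listed in lexicographic order of labels): Chop with premises for $P$ and $Q$ ending in $\mathsf{let}\ p=\lambda\rho.P\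 \mathsf{in}\ Q$ $\mapsto(\nu x^p\,y^p)([\![Q]\!]\mid y^p(z_1).\cdots.y^p(z_k).y^p().[\![P]\!])$ (restriction typed $[\![\Delta]\!]$); Id $p\langle\rho\rangle\mapsto x^p[z_1].\cdots.x^p[z_k].x^p[\,]$ (free outputs); $\mathsf{send}$: $x[\lambda\rho.P]\mapsto x[y].(y(z_1).\cdots.y(z_k).y().[\![P]\!]\mid x[\,])$; $\mathsf{recv}$: $x(p).Q\mapsto x(x^p).x().[\![Q]\!]$; Axiom $x\leftrightarrow^A y\mapsto x\leftrightarrow^{[\![A]\!]}y$; Cut $(\nu x^Ay)(P\mid Q)\mapsto(\nu x^{[\![A]\!]}y)([\![P]\!]\mid[\![Q]\!])$; $\exists$: $x[A].P\mapsto x[[\![A]\!]].[\![P]\!]$; Weaken $\mapsto$ the translation of the premise; Contract $\mapsto$ the translation of the premise with $x$ substituted for $y$ and $z$; every other rule maps its term constructor to the same constructor applied to the translations of the premises (e.g. $x[y].(P\mid Q)\mapsto x[y].([\![P]\!]\mid[\![Q]\!])$, $x.\mathsf{case}(P,Q)\mapsto x.\mathsf{case}([\![P]\!],[\![Q]\!])$, $x[\,]\mapsto x[\,]$, $x.\mathsf{case}()\mapsto x.\mathsf{case}()$). -}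

module Defs where

-- Conventions:
--  * channel names, process variables, labels are natural numbers;
--  * type variables are de Bruijn indices (quantifiers bind index 0);
--  * contexts are lists of key/type pairs with an explicit exchange rule
--    (order irrelevant) and every rule requires the keys of its conclusion
--    to be pairwise distinct (contexts are finite maps);
--  * label-keyed contexts and records are lists, read in list order, which
--    is lexicographic order for their canonical (sorted) representation.

open import Data.Nat using (ℕ; zero; suc; pred; _<ᵇ_; _≡ᵇ_)
open import Data.Bool using (Bool; true; false; if_then_else_; _∧_; _∨_)
open import Data.List using (List; []; _∷_; map; _++_)
open import Data.Product using (_×_; _,_; proj₁; proj₂; Σ)
open import Data.List.Relation.Unary.All using (All)
open import Data.List.Relation.Unary.Unique.Propositional using (Unique)
open import Data.List.Relation.Binary.Permutation.Propositional using (_↭_)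
open import Data.List.Membership.Propositional using (_∈_; _∉_)
open import Relation.Binary.PropositionalEquality using (_≡_; refl; cong; cong₂)

Label : Set
Label = ℕ

Chan : Set
Chan = ℕ

PVar : Set
PVar = ℕ

bump : ℕ → ℕ → ℕ
bump c n = if n <ᵇ c then n else suc n

module CHOP where

  infixr 6 _⊗_ _⅋_ _⊕_ _&_

  -- session types; ∃ᵗ and ∀ᵗ bind de Bruijn index 0;
  -- var n is the type variable X_n, dvar n is X_n^⊥
  data Ty : Set where
    _⊗_ _⅋_ _⊕_ _&_ : Ty → Ty → Ty
    𝟘 ⊤ 𝟙 ⊥ : Ty
    ¿_ !_ : Ty → Ty
    ∃ᵗ ∀ᵗ : Ty → Ty
    var dvar : ℕ → Ty
    send recv : List (Label × Ty) → Ty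

  -- label-keyed process types (inside send/recv and in Θ)
  LCtx : Set
  LCtx = List (Label × Ty)

  Ctx : Set
  Ctx = List (Chan × Ty)

  PEnv : Set
  PEnv = List (PVar × LCtx)

  Rec : Set
  Rec = List (Label × Chan)

  dual : Ty → Ty
  dual (A ⊗ B) = dual A ⅋ dual B
  dual (A ⅋ B) = dual A ⊗ dual B
  dual (A ⊕ B) = dual A & dual B
  dual (A & B) = dual A ⊕ dual B
  dual 𝟘 = ⊤
  dual ⊤ = 𝟘
  dual 𝟙 = ⊥
  dual ⊥ = 𝟙
  dual (¿ A) = ! dual A
  dual (! A) = ¿ dual A
  dual (∃ᵗ A) = ∀ᵗ (dual A)
  dual (∀ᵗ A) = ∃ᵗ (dual A)
  dual (var n) = dvar n
  dual (dvar n) = var n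
  dual (send Γ) = recv Γ
  dual (recv Γ) = send Γ

  -- shifting free type variables ≥ c (used for "X not free in Θ,Γ")
  shift : ℕ → Ty → Ty
  shiftL : ℕ → LCtx → LCtx
  shift c (A ⊗ B) = shift c A ⊗ shift c B
  shift c (A ⅋ B) = shift c A ⅋ shift c B
  shift c (A ⊕ B) = shift c A ⊕ shift c B
  shift c (A & B) = shift c A & shift c B
  shift c 𝟘 = 𝟘
  shift c ⊤ = ⊤
  shift c 𝟙 = 𝟙
  shift c ⊥ = ⊥
  shift c (¿ A) = ¿ shift c A
  shift c (! A) = ! shift c A
  shift c (∃ᵗ A) = ∃ᵗ (shift (suc c) A)
  shift c (∀ᵗ A) = ∀ᵗ (shift (suc c) A)
  shift c (var n) = var (bump c n)
  shift c (dvar n) = dvar (bump c n)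
  shift c (send Γ) = send (shiftL c Γ)
  shift c (recv Γ) = recv (shiftL c Γ)
  shiftL c [] = []
  shiftL c ((l , A) ∷ Γ) = (l , shift c A) ∷ shiftL c Γ

  subst : ℕ → Ty → Ty → Ty
  substL : ℕ → Ty → LCtx → LCtx
  subst k A (B ⊗ C) = subst k A B ⊗ subst k A C
  subst k A (B ⅋ C) = subst k A B ⅋ subst k A C
  subst k A (B ⊕ C) = subst k A B ⊕ subst k A C
  subst k A (B & C) = subst k A B & subst k A C
  subst k A 𝟘 = 𝟘
  subst k A ⊤ = ⊤
  subst k A 𝟙 = 𝟙
  subst k A ⊥ = ⊥
  subst k A (¿ B) = ¿ subst k A B
  subst k A (! B) = ! subst k A B
  subst k A (∃ᵗ B) = ∃ᵗ (subst (suc k) (shift 0 A) B)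
  subst k A (∀ᵗ B) = ∀ᵗ (subst (suc k) (shift 0 A) B)
  subst k A (var n) = if n ≡ᵇ k then A else (if k <ᵇ n then var (pred n) else var n)
  subst k A (dvar n) = if n ≡ᵇ k then dual A else (if k <ᵇ n then dvar (pred n) else dvar n)
  subst k A (send Γ) = send (substL k A Γ)
  subst k A (recv Γ) = recv (substL k A Γ)
  substL k A [] = []
  substL k A ((l , B) ∷ Γ) = (l , subst k A B) ∷ substL k A Γ

  shiftC : Ctx → Ctx
  shiftC = map (λ e → proj₁ e , shift 0 (proj₂ e))

  shiftE : PEnv → PEnv
  shiftE = map (λ e → proj₁ e , shiftL 0 (proj₂ e))

  data Proc : Set where
    out    : Chan → Chan → Proc → Proc → Proc   -- x[y].(P | Q), y bound in P
    inp    : Chan → Chan → Proc → Proc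
    inl    : Chan → Proc → Proc
    inr    : Chan → Proc → Proc
    case   : Chan → Proc → Proc → Proc
    wn     : Chan → Chan → Proc → Proc
    oc     : Chan → Chan → Proc → Proc
    outT   : Chan → Ty → Proc → Proc
    inpT   : Chan → Proc → Proc                 -- x(X).P  (X = de Bruijn 0 in P)
    outAbs : Chan → Rec → Proc → Proc
    inpAbs : Chan → PVar → Proc → Proc
    run    : PVar → Rec → Proc
    close  : Chan → Proc
    wait   : Chan → Proc → Proc
    caseZ  : Chan → Proc
    link   : Chan → Ty → Chan → Proc            -- x ↔^A y
    nu     : Chan → Ty → Chan → Proc → Proc → Proc  -- (ν x^A y)(P | Q)
    letp   : PVar → Rec → Proc → Proc → Proc    -- let p = λρ.Q in P  (letp p ρ Q P)

  images : Rec → List Chan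
  images = map proj₂

  memb : Chan → List Chan → Bool
  memb x [] = false
  memb x (y ∷ ys) = (x ≡ᵇ y) ∨ memb x ys

  -- ren x y P = P{x/y}: replace free occurrences of y by x
  ren : Chan → Chan → Proc → Proc
  ren x y P = go P
    where
    r : Chan → Chan
    r z = if z ≡ᵇ y then x else z
    rρ : Rec → Rec
    rρ = map (λ e → proj₁ e , r (proj₂ e))
    go : Proc → Proc
    under : Chan → Proc → Proc
    underρ : Rec → Proc → Proc
    under b Q = if b ≡ᵇ y then Q else go Q
    underρ ρ Q = if memb y (images ρ) then Q else go Q
    go (out a b P Q) = out (r a) b (under b P) (go Q)
    go (inp a b P) = inp (r a) b (under b P)
    go (inl a P) = inl (r a) (go P)
    go (inr a P) = inr (r a) (go P)
    go (case a P Q) = case (r a) (go P) (go Q)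
    go (wn a b P) = wn (r a) b (under b P)
    go (oc a b P) = oc (r a) b (under b P)
    go (outT a A P) = outT (r a) A (go P)
    go (inpT a P) = inpT (r a) (go P)
    go (outAbs a ρ P) = outAbs (r a) ρ (underρ ρ P)
    go (inpAbs a p P) = inpAbs (r a) p (go P)
    go (run p ρ) = run p (rρ ρ)
    go (close a) = close (r a)
    go (wait a P) = wait (r a) (go P)
    go (caseZ a) = caseZ (r a)
    go (link a A b) = link (r a) A (r b)
    go (nu a A b P Q) = nu a A b (under a P) (under b Q)
    go (letp p ρ Q P) = letp p ρ (underρ ρ Q) (go P)

  contractP : Chan → Chan → Chan → Proc → Proc
  contractP x y z P = ren x y (ren x z P)

  bnd : Proc → List Chan
  bnd (out a b P Q) = b ∷ bnd P ++ bnd Q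
  bnd (inp a b P) = b ∷ bnd P
  bnd (inl a P) = bnd P
  bnd (inr a P) = bnd P
  bnd (case a P Q) = bnd P ++ bnd Q
  bnd (wn a b P) = b ∷ bnd P
  bnd (oc a b P) = b ∷ bnd P
  bnd (outT a A P) = bnd P
  bnd (inpT a P) = bnd P
  bnd (outAbs a ρ P) = images ρ ++ bnd P
  bnd (inpAbs a p P) = bnd P
  bnd (run p ρ) = []
  bnd (close a) = []
  bnd (wait a P) = bnd P
  bnd (caseZ a) = []
  bnd (link a A b) = []
  bnd (nu a A b P Q) = a ∷ b ∷ bnd P ++ bnd Q
  bnd (letp p ρ Q P) = images ρ ++ bnd Q ++ bnd P

  -- Γρ : Inst ρ Δ Γ says that Γ = Δρ (ρ and Δ have the same labels)
  data Inst : Rec → LCtx → Ctx → Set where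
    nil  : Inst [] [] []
    cons : ∀ {l x A ρ Δ Γ} → Inst ρ Δ Γ → Inst ((l , x) ∷ ρ) ((l , A) ∷ Δ) ((x , A) ∷ Γ)

  IsWn : Ty → Set
  IsWn A = Σ Ty (λ B → A ≡ ¿ B)

  AllWn : Ctx → Set
  AllWn Γ = All (λ e → IsWn (proj₂ e)) Γ

  WF : PEnv → Ctx → Set
  WF Θ Γ = Unique (map proj₁ Θ) × Unique (map proj₁ Γ)

  infix 3 _⊢_⦂_

  data _⊢_⦂_ : PEnv → Proc → Ctx → Set where
    exch : ∀ {Θ Θ' P Γ Γ'} → Θ ↭ Θ' → Γ ↭ Γ' → Θ ⊢ P ⦂ Γ → Θ' ⊢ P ⦂ Γ'
    ax : ∀ {x y A} → WF [] ((x , dual A) ∷ (y , A) ∷ []) →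
         [] ⊢ link x A y ⦂ (x , dual A) ∷ (y , A) ∷ []
    cut : ∀ {Θ Θ' P Q Γ Δ x y A} → WF (Θ ++ Θ') (Γ ++ Δ) →
          Θ ⊢ P ⦂ (x , A) ∷ Γ → Θ' ⊢ Q ⦂ (y , dual A) ∷ Δ →
          Θ ++ Θ' ⊢ nu x A y P Q ⦂ Γ ++ Δ
    tensor : ∀ {Θ Θ' P Q Γ Δ x y A B} → WF (Θ ++ Θ') ((x , A ⊗ B) ∷ Γ ++ Δ) →
          Θ ⊢ P ⦂ (y , A) ∷ Γ → Θ' ⊢ Q ⦂ (x , B) ∷ Δ →
          Θ ++ Θ' ⊢ out x y P Q ⦂ (x , A ⊗ B) ∷ Γ ++ Δ
    par : ∀ {Θ P Γ x y A B} → WF Θ ((x , A ⅋ B) ∷ Γ) →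
          Θ ⊢ P ⦂ (y , A) ∷ (x , B) ∷ Γ →
          Θ ⊢ inp x y P ⦂ (x , A ⅋ B) ∷ Γ
    plus₁ : ∀ {Θ P Γ x A B} → WF Θ ((x , A ⊕ B) ∷ Γ) →
          Θ ⊢ P ⦂ (x , A) ∷ Γ → Θ ⊢ inl x P ⦂ (x , A ⊕ B) ∷ Γ
    plus₂ : ∀ {Θ P Γ x A B} → WF Θ ((x , A ⊕ B) ∷ Γ) →
          Θ ⊢ P ⦂ (x , B) ∷ Γ → Θ ⊢ inr x P ⦂ (x , A ⊕ B) ∷ Γ
    with& : ∀ {Θ P Q Γ x A B} → WF Θ ((x , A & B) ∷ Γ) →
          Θ ⊢ P ⦂ (x , A) ∷ Γ → Θ ⊢ Q ⦂ (x , B) ∷ Γ →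
          Θ ⊢ case x P Q ⦂ (x , A & B) ∷ Γ
    why : ∀ {Θ P Γ x y A} → WF Θ ((x , ¿ A) ∷ Γ) →
          Θ ⊢ P ⦂ (y , A) ∷ Γ → Θ ⊢ wn x y P ⦂ (x , ¿ A) ∷ Γ
    bang : ∀ {P Γ x y A} → WF [] ((x , ! A) ∷ Γ) → AllWn Γ →
          [] ⊢ P ⦂ (y , A) ∷ Γ → [] ⊢ oc x y P ⦂ (x , ! A) ∷ Γ
    exists : ∀ {Θ P Γ x A B} → WF Θ ((x , ∃ᵗ B) ∷ Γ) →
          Θ ⊢ P ⦂ (x , subst 0 A B) ∷ Γ → Θ ⊢ outT x A P ⦂ (x , ∃ᵗ B) ∷ Γ
    all∀ : ∀ {Θ P Γ x B} → WF Θ ((x , ∀ᵗ B) ∷ Γ) →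
          shiftE Θ ⊢ P ⦂ (x , B) ∷ shiftC Γ → Θ ⊢ inpT x P ⦂ (x , ∀ᵗ B) ∷ Γ
    weaken : ∀ {Θ P Γ x A} → WF Θ ((x , ¿ A) ∷ Γ) →
          Θ ⊢ P ⦂ Γ → Θ ⊢ P ⦂ (x , ¿ A) ∷ Γ
    contract : ∀ {Θ P Γ x y z A} → WF Θ ((x , ¿ A) ∷ Γ) → x ∉ bnd P →
          Θ ⊢ P ⦂ (y , ¿ A) ∷ (z , ¿ A) ∷ Γ →
          Θ ⊢ contractP x y z P ⦂ (x , ¿ A) ∷ Γ
    one : ∀ {x} → WF [] ((x , 𝟙) ∷ []) → [] ⊢ close x ⦂ (x , 𝟙) ∷ []
    bot : ∀ {Θ P Γ x} → WF Θ ((x , ⊥) ∷ Γ) →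
          Θ ⊢ P ⦂ Γ → Θ ⊢ wait x P ⦂ (x , ⊥) ∷ Γ
    top : ∀ {Θ Γ x} → WF Θ ((x , ⊤) ∷ Γ) → Θ ⊢ caseZ x ⦂ (x , ⊤) ∷ Γ
    id : ∀ {p ρ Δ Γ} → WF ((p , Δ) ∷ []) Γ → Inst ρ Δ Γ →
          (p , Δ) ∷ [] ⊢ run p ρ ⦂ Γ
    chop : ∀ {Θ Θ' P Q p ρ Δ Γ Γ'} → WF (Θ ++ Θ') Γ → Inst ρ Δ Γ' →
          Θ ⊢ P ⦂ Γ' → (p , Δ) ∷ Θ' ⊢ Q ⦂ Γ →
          Θ ++ Θ' ⊢ letp p ρ P Q ⦂ Γ
    snd : ∀ {Θ P Γ Γ' x ρ} → WF Θ ((x , send Γ) ∷ []) → Inst ρ Γ Γ' →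
          Θ ⊢ P ⦂ Γ' → Θ ⊢ outAbs x ρ P ⦂ (x , send Γ) ∷ []
    rcv : ∀ {Θ P Γ Δ x p} → WF Θ ((x , recv Δ) ∷ Γ) →
          (p , Δ) ∷ Θ ⊢ P ⦂ Γ → Θ ⊢ inpAbs x p P ⦂ (x , recv Δ) ∷ Γ

module CP where

  infixr 6 _⊗_ _⅋_ _⊕_ _&_

  data Ty : Set where
    _⊗_ _⅋_ _⊕_ _&_ : Ty → Ty → Ty
    𝟘 ⊤ 𝟙 ⊥ : Ty
    ¿_ !_ : Ty → Ty
    ∃ᵗ ∀ᵗ : Ty → Ty
    var dvar : ℕ → Ty

  -- CP channel names: the CHOP names (ch x), the families x^p, y^p used
  -- by the translation, and one further name w₀ used as the "fresh" name
  -- of the translation (never free in a translated process)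
  data Ch : Set where
    ch xp yp : ℕ → Ch
    w₀ : Ch

  _==_ : Ch → Ch → Bool
  ch m == ch n = m ≡ᵇ n
  xp m == xp n = m ≡ᵇ n
  yp m == yp n = m ≡ᵇ n
  w₀ == w₀ = true
  _ == _ = false

  Ctx : Set
  Ctx = List (Ch × Ty)

  dual : Ty → Ty
  dual (A ⊗ B) = dual A ⅋ dual B
  dual (A ⅋ B) = dual A ⊗ dual B
  dual (A ⊕ B) = dual A & dual B
  dual (A & B) = dual A ⊕ dual B
  dual 𝟘 = ⊤
  dual ⊤ = 𝟘
  dual 𝟙 = ⊥
  dual ⊥ = 𝟙
  dual (¿ A) = ! dual A
  dual (! A) = ¿ dual A
  dual (∃ᵗ A) = ∀ᵗ (dual A)
  dual (∀ᵗ A) = ∃ᵗ (dual A)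
  dual (var n) = dvar n
  dual (dvar n) = var n

  shift : ℕ → Ty → Ty
  shift c (A ⊗ B) = shift c A ⊗ shift c B
  shift c (A ⅋ B) = shift c A ⅋ shift c B
  shift c (A ⊕ B) = shift c A ⊕ shift c B
  shift c (A & B) = shift c A & shift c B
  shift c 𝟘 = 𝟘
  shift c ⊤ = ⊤
  shift c 𝟙 = 𝟙
  shift c ⊥ = ⊥
  shift c (¿ A) = ¿ shift c A
  shift c (! A) = ! shift c A
  shift c (∃ᵗ A) = ∃ᵗ (shift (suc c) A)
  shift c (∀ᵗ A) = ∀ᵗ (shift (suc c) A)
  shift c (var n) = var (bump c n)
  shift c (dvar n) = dvar (bump c n)

  subst : ℕ → Ty → Ty → Ty
  subst k A (B ⊗ C) = subst k A B ⊗ subst k A C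
  subst k A (B ⅋ C) = subst k A B ⅋ subst k A C
  subst k A (B ⊕ C) = subst k A B ⊕ subst k A C
  subst k A (B & C) = subst k A B & subst k A C
  subst k A 𝟘 = 𝟘
  subst k A ⊤ = ⊤
  subst k A 𝟙 = 𝟙
  subst k A ⊥ = ⊥
  subst k A (¿ B) = ¿ subst k A B
  subst k A (! B) = ! subst k A B
  subst k A (∃ᵗ B) = ∃ᵗ (subst (suc k) (shift 0 A) B)
  subst k A (∀ᵗ B) = ∀ᵗ (subst (suc k) (shift 0 A) B)
  subst k A (var n) = if n ≡ᵇ k then A else (if k <ᵇ n then var (pred n) else var n)
  subst k A (dvar n) = if n ≡ᵇ k then dual A else (if k <ᵇ n then dvar (pred n) else dvar n)

  shiftC : Ctx → Ctx
  shiftC = map (λ e → proj₁ e , shift 0 (proj₂ e))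

  data Proc : Set where
    out    : Ch → Ch → Proc → Proc → Proc
    inp    : Ch → Ch → Proc → Proc
    inl    : Ch → Proc → Proc
    inr    : Ch → Proc → Proc
    case   : Ch → Proc → Proc → Proc
    wn     : Ch → Ch → Proc → Proc
    oc     : Ch → Ch → Proc → Proc
    outT   : Ch → Ty → Proc → Proc
    inpT   : Ch → Proc → Proc
    close  : Ch → Proc
    wait   : Ch → Proc → Proc
    caseZ  : Ch → Proc
    link   : Ch → Ty → Ch → Proc
    nu     : Ch → Ty → Ch → Proc → Proc → Proc

  ren : Ch → Ch → Proc → Proc
  ren x y P = go P
    where
    r : Ch → Ch
    r z = if z == y then x else z
    go : Proc → Proc
    under : Ch → Proc → Proc
    under b Q = if b == y then Q else go Q
    go (out a b P Q) = out (r a) b (under b P) (go Q)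
    go (inp a b P) = inp (r a) b (under b P)
    go (inl a P) = inl (r a) (go P)
    go (inr a P) = inr (r a) (go P)
    go (case a P Q) = case (r a) (go P) (go Q)
    go (wn a b P) = wn (r a) b (under b P)
    go (oc a b P) = oc (r a) b (under b P)
    go (outT a A P) = outT (r a) A (go P)
    go (inpT a P) = inpT (r a) (go P)
    go (close a) = close (r a)
    go (wait a P) = wait (r a) (go P)
    go (caseZ a) = caseZ (r a)
    go (link a A b) = link (r a) A (r b)
    go (nu a A b P Q) = nu a A b (under a P) (under b Q)

  contractP : Ch → Ch → Ch → Proc → Proc
  contractP x y z P = ren x y (ren x z P)

  bnd : Proc → List Ch
  bnd (out a b P Q) = b ∷ bnd P ++ bnd Q
  bnd (inp a b P) = b ∷ bnd P
  bnd (inl a P) = bnd P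
  bnd (inr a P) = bnd P
  bnd (case a P Q) = bnd P ++ bnd Q
  bnd (wn a b P) = b ∷ bnd P
  bnd (oc a b P) = b ∷ bnd P
  bnd (outT a A P) = bnd P
  bnd (inpT a P) = bnd P
  bnd (close a) = []
  bnd (wait a P) = bnd P
  bnd (caseZ a) = []
  bnd (link a A b) = []
  bnd (nu a A b P Q) = a ∷ b ∷ bnd P ++ bnd Q

  IsWn : Ty → Set
  IsWn A = Σ Ty (λ B → A ≡ ¿ B)

  AllWn : Ctx → Set
  AllWn Γ = All (λ e → IsWn (proj₂ e)) Γ

  WF : Ctx → Set
  WF Γ = Unique (map proj₁ Γ)

  infix 3 ⊢_⦂_

  data ⊢_⦂_ : Proc → Ctx → Set where
    exch : ∀ {P Γ Γ'} → Γ ↭ Γ' → ⊢ P ⦂ Γ → ⊢ P ⦂ Γ'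
    ax : ∀ {x y A} → WF ((x , dual A) ∷ (y , A) ∷ []) →
         ⊢ link x A y ⦂ (x , dual A) ∷ (y , A) ∷ []
    cut : ∀ {P Q Γ Δ x y A} → WF (Γ ++ Δ) →
          ⊢ P ⦂ (x , A) ∷ Γ → ⊢ Q ⦂ (y , dual A) ∷ Δ →
          ⊢ nu x A y P Q ⦂ Γ ++ Δ
    tensor : ∀ {P Q Γ Δ x y A B} → WF ((x , A ⊗ B) ∷ Γ ++ Δ) →
          ⊢ P ⦂ (y , A) ∷ Γ → ⊢ Q ⦂ (x , B) ∷ Δ →
          ⊢ out x y P Q ⦂ (x , A ⊗ B) ∷ Γ ++ Δ
    par : ∀ {P Γ x y A B} → WF ((x , A ⅋ B) ∷ Γ) →
          ⊢ P ⦂ (y , A) ∷ (x , B) ∷ Γ → ⊢ inp x y P ⦂ (x , A ⅋ B) ∷ Γ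
    plus₁ : ∀ {P Γ x A B} → WF ((x , A ⊕ B) ∷ Γ) →
          ⊢ P ⦂ (x , A) ∷ Γ → ⊢ inl x P ⦂ (x , A ⊕ B) ∷ Γ
    plus₂ : ∀ {P Γ x A B} → WF ((x , A ⊕ B) ∷ Γ) →
          ⊢ P ⦂ (x , B) ∷ Γ → ⊢ inr x P ⦂ (x , A ⊕ B) ∷ Γ
    with& : ∀ {P Q Γ x A B} → WF ((x , A & B) ∷ Γ) →
          ⊢ P ⦂ (x , A) ∷ Γ → ⊢ Q ⦂ (x , B) ∷ Γ → ⊢ case x P Q ⦂ (x , A & B) ∷ Γ
    why : ∀ {P Γ x y A} → WF ((x , ¿ A) ∷ Γ) →
          ⊢ P ⦂ (y , A) ∷ Γ → ⊢ wn x y P ⦂ (x , ¿ A) ∷ Γ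
    bang : ∀ {P Γ x y A} → WF ((x , ! A) ∷ Γ) → AllWn Γ →
          ⊢ P ⦂ (y , A) ∷ Γ → ⊢ oc x y P ⦂ (x , ! A) ∷ Γ
    exists : ∀ {P Γ x A B} → WF ((x , ∃ᵗ B) ∷ Γ) →
          ⊢ P ⦂ (x , subst 0 A B) ∷ Γ → ⊢ outT x A P ⦂ (x , ∃ᵗ B) ∷ Γ
    all∀ : ∀ {P Γ x B} → WF ((x , ∀ᵗ B) ∷ Γ) →
          ⊢ P ⦂ (x , B) ∷ shiftC Γ → ⊢ inpT x P ⦂ (x , ∀ᵗ B) ∷ Γ
    weaken : ∀ {P Γ x A} → WF ((x , ¿ A) ∷ Γ) →
          ⊢ P ⦂ Γ → ⊢ P ⦂ (x , ¿ A) ∷ Γ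
    contract : ∀ {P Γ x y z A} → WF ((x , ¿ A) ∷ Γ) → x ∉ bnd P →
          ⊢ P ⦂ (y , ¿ A) ∷ (z , ¿ A) ∷ Γ →
          ⊢ contractP x y z P ⦂ (x , ¿ A) ∷ Γ
    one : ∀ {x} → WF ((x , 𝟙) ∷ []) → ⊢ close x ⦂ (x , 𝟙) ∷ []
    bot : ∀ {P Γ x} → WF ((x , ⊥) ∷ Γ) → ⊢ P ⦂ Γ → ⊢ wait x P ⦂ (x , ⊥) ∷ Γ
    top : ∀ {Γ x} → WF ((x , ⊤) ∷ Γ) → ⊢ caseZ x ⦂ (x , ⊤) ∷ Γ

module Translation where
  open CHOP
  module C = CP

  -- ⟦ A ⟧ and ⟦ A^⊥ ⟧ (the latter by mutual structural recursion, see
  -- trDual-correct below), and ⟦ Δ ⟧ for label-keyed Δ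
  ⟦_⟧ : Ty → C.Ty
  ⟦_⟧⊥ : Ty → C.Ty
  ⟦_⟧L : LCtx → C.Ty
  ⟦ A ⊗ B ⟧ = ⟦ A ⟧ C.⊗ ⟦ B ⟧
  ⟦ A ⅋ B ⟧ = ⟦ A ⟧ C.⅋ ⟦ B ⟧
  ⟦ A ⊕ B ⟧ = ⟦ A ⟧ C.⊕ ⟦ B ⟧
  ⟦ A & B ⟧ = ⟦ A ⟧ C.& ⟦ B ⟧
  ⟦ 𝟘 ⟧ = C.𝟘
  ⟦ ⊤ ⟧ = C.⊤
  ⟦ 𝟙 ⟧ = C.𝟙
  ⟦ ⊥ ⟧ = C.⊥
  ⟦ ¿ A ⟧ = C.¿ ⟦ A ⟧
  ⟦ ! A ⟧ = C.! ⟦ A ⟧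
  ⟦ ∃ᵗ A ⟧ = C.∃ᵗ ⟦ A ⟧
  ⟦ ∀ᵗ A ⟧ = C.∀ᵗ ⟦ A ⟧
  ⟦ var n ⟧ = C.var n
  ⟦ dvar n ⟧ = C.dvar n
  ⟦ send Δ ⟧ = C.dual ⟦ Δ ⟧L C.⊗ C.𝟙
  ⟦ recv Δ ⟧ = ⟦ Δ ⟧L C.⅋ C.⊥
  ⟦ A ⊗ B ⟧⊥ = ⟦ A ⟧⊥ C.⅋ ⟦ B ⟧⊥
  ⟦ A ⅋ B ⟧⊥ = ⟦ A ⟧⊥ C.⊗ ⟦ B ⟧⊥
  ⟦ A ⊕ B ⟧⊥ = ⟦ A ⟧⊥ C.& ⟦ B ⟧⊥
  ⟦ A & B ⟧⊥ = ⟦ A ⟧⊥ C.⊕ ⟦ B ⟧⊥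
  ⟦ 𝟘 ⟧⊥ = C.⊤
  ⟦ ⊤ ⟧⊥ = C.𝟘
  ⟦ 𝟙 ⟧⊥ = C.⊥
  ⟦ ⊥ ⟧⊥ = C.𝟙
  ⟦ ¿ A ⟧⊥ = C.! ⟦ A ⟧⊥
  ⟦ ! A ⟧⊥ = C.¿ ⟦ A ⟧⊥
  ⟦ ∃ᵗ A ⟧⊥ = C.∀ᵗ ⟦ A ⟧⊥
  ⟦ ∀ᵗ A ⟧⊥ = C.∃ᵗ ⟦ A ⟧⊥
  ⟦ var n ⟧⊥ = C.dvar n
  ⟦ dvar n ⟧⊥ = C.var n
  ⟦ send Δ ⟧⊥ = ⟦ Δ ⟧L C.⅋ C.⊥
  ⟦ recv Δ ⟧⊥ = C.dual ⟦ Δ ⟧L C.⊗ C.𝟙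
  ⟦ [] ⟧L = C.𝟙
  ⟦ (l , A) ∷ Δ ⟧L = ⟦ A ⟧⊥ C.⊗ ⟦ Δ ⟧L

  trDual-correct : ∀ A → ⟦ A ⟧⊥ ≡ ⟦ dual A ⟧
  trDual-correct (A ⊗ B) = cong₂ C._⅋_ (trDual-correct A) (trDual-correct B)
  trDual-correct (A ⅋ B) = cong₂ C._⊗_ (trDual-correct A) (trDual-correct B)
  trDual-correct (A ⊕ B) = cong₂ C._&_ (trDual-correct A) (trDual-correct B)
  trDual-correct (A & B) = cong₂ C._⊕_ (trDual-correct A) (trDual-correct B)
  trDual-correct 𝟘 = refl
  trDual-correct ⊤ = refl
  trDual-correct 𝟙 = refl
  trDual-correct ⊥ = refl
  trDual-correct (¿ A) = cong C.!_ (trDual-correct A)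
  trDual-correct (! A) = cong C.¿_ (trDual-correct A)
  trDual-correct (∃ᵗ A) = cong C.∀ᵗ (trDual-correct A)
  trDual-correct (∀ᵗ A) = cong C.∃ᵗ (trDual-correct A)
  trDual-correct (var n) = refl
  trDual-correct (dvar n) = refl
  trDual-correct (send Δ) = refl
  trDual-correct (recv Δ) = refl

  ⟦_⟧C : Ctx → C.Ctx
  ⟦_⟧C = map (λ e → C.ch (proj₁ e) , ⟦ proj₂ e ⟧)

  ⟦_⟧E : PEnv → C.Ctx
  ⟦_⟧E = map (λ e → C.xp (proj₁ e) , ⟦ proj₂ e ⟧L)

  inputs : C.Ch → List Chan → C.Proc → C.Proc
  inputs y [] P = C.wait y P
  inputs y (z ∷ zs) P = C.inp y (C.ch z) (inputs y zs P)

  -- x[z₁].⋯.x[z_k].x[] with free outputs x[z].P := x[w₀].(z ↔ w₀ | P);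
  -- the axiom annotation is the type ⟦ Aᵢ^⊥ ⟧ of the sent channel
  outputs : C.Ch → ∀ {ρ Δ Γ} → Inst ρ Δ Γ → C.Proc
  outputs x nil = C.close x
  outputs x (cons {x = z} {A = A} i) =
    C.out x C.w₀ (C.link (C.ch z) ⟦ A ⟧⊥ C.w₀) (outputs x i)

  tr : ∀ {Θ P Γ} → Θ ⊢ P ⦂ Γ → C.Proc
  tr (exch _ _ d) = tr d
  tr (ax {x} {y} {A} _) = C.link (C.ch x) ⟦ A ⟧ (C.ch y)
  tr (cut {x = x} {y} {A} _ d e) = C.nu (C.ch x) ⟦ A ⟧ (C.ch y) (tr d) (tr e)
  tr (tensor {x = x} {y} _ d e) = C.out (C.ch x) (C.ch y) (tr d) (tr e)
  tr (par {x = x} {y} _ d) = C.inp (C.ch x) (C.ch y) (tr d)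
  tr (plus₁ {x = x} _ d) = C.inl (C.ch x) (tr d)
  tr (plus₂ {x = x} _ d) = C.inr (C.ch x) (tr d)
  tr (with& {x = x} _ d e) = C.case (C.ch x) (tr d) (tr e)
  tr (why {x = x} {y} _ d) = C.wn (C.ch x) (C.ch y) (tr d)
  tr (bang {x = x} {y} _ _ d) = C.oc (C.ch x) (C.ch y) (tr d)
  tr (exists {x = x} {A} _ d) = C.outT (C.ch x) ⟦ A ⟧ (tr d)
  tr (all∀ {x = x} _ d) = C.inpT (C.ch x) (tr d)
  tr (weaken _ d) = tr d
  tr (contract {x = x} {y} {z} _ _ d) = C.contractP (C.ch x) (C.ch y) (C.ch z) (tr d)
  tr (one {x} _) = C.close (C.ch x)
  tr (bot {x = x} _ d) = C.wait (C.ch x) (tr d)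
  tr (top {x = x} _) = C.caseZ (C.ch x)
  tr (id {p = p} _ i) = outputs (C.xp p) i
  tr (chop {p = p} {ρ} {Δ} _ _ d e) =
    C.nu (C.xp p) ⟦ Δ ⟧L (C.yp p) (tr e) (inputs (C.yp p) (images ρ) (tr d))
  tr (snd {x = x} {ρ} _ _ d) =
    C.out (C.ch x) C.w₀ (inputs C.w₀ (images ρ) (tr d)) (C.close (C.ch x))
  tr (rcv {x = x} {p} _ d) = C.inp (C.ch x) (C.xp p) (C.wait (C.ch x) (tr d))

-- A process variable p : Δ becomes a channel x^p of type
-- ⟦Δ⟧ = ⟦A₁^⊥⟧ ⊗ ⋯ ⊗ ⟦Aₙ^⊥⟧ ⊗ 1: running p⟨ρ⟩ sends the n parameters along x^p by
-- forwarding, and a let-binding (or a sent abstraction) receives them on the dual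
-- end ⟦Δ⟧^⊥ = ⟦A₁⟧ ⅋ ⋯ ⅋ ⟦Aₙ⟧ ⅋ ⊥ before running the body.  The rest is bookkeeping:
-- translation commutes with duality, shifting and substitution of types, translated
-- contexts have pairwise distinct channels, and the translation binds no CHOP channel
-- that was not already bound, which preserves the side condition of contraction.
module Submission where

open import Defs
open import Data.List using (_++_)
open Defs.CHOP using (_⊢_⦂_)
open Defs.CP using (⊢_⦂_)
open Defs.Translation using (tr; ⟦_⟧E; ⟦_⟧C)

open import Data.Bool using (true; false; if_then_else_)
open import Data.List using (List; []; _∷_; map; [_])
open import Data.List.Properties using (map-++; ++-assoc; ++-identityʳ)
open import Data.List.Membership.Propositional using (_∈_)
open import Data.List.Membership.Propositional.Properties using (∈-map⁻)
open import Data.List.Relation.Binary.Disjoint.Propositional using (Disjoint)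
open import Data.List.Relation.Binary.Permutation.Propositional
  using (_↭_; refl; prep; swap; ↭-sym; ↭-trans; ↭-reflexive; ↭⇒↭ₛ; module PermutationReasoning)
open import Data.List.Relation.Binary.Permutation.Propositional.Properties
  using (++-comm; shifts) renaming (shift to ↭-shift; map⁺ to ↭-map⁺; ++⁺ to ↭-++⁺; ++⁺ˡ to ↭-++⁺ˡ)
open import Data.List.Relation.Binary.Subset.Propositional using (_⊆_)
open import Data.List.Relation.Binary.Subset.Propositional.Properties
  using (⊆-trans; ⊆-reflexive; ⊆-reflexive-↭; ++⁺; ++⁺ʳ)
open import Data.List.Relation.Unary.All using (All; []; _∷_)
open import Data.List.Relation.Unary.Any using (here; there)
open import Data.List.Relation.Unary.AllPairs using ([]; _∷_)
open import Data.List.Relation.Unary.Unique.Propositional using (Unique)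
import Data.List.Relation.Unary.Unique.Propositional.Properties as Unique
open import Data.Nat using (suc; _≡ᵇ_; _<ᵇ_)
open import Data.Product using (_×_; _,_; proj₁)
open import Relation.Binary.PropositionalEquality
  using (_≡_; _≢_; refl; sym; trans; cong; cong₂; subst; subst₂; setoid; module ≡-Reasoning)
open import Data.List.Relation.Binary.Permutation.Setoid.Properties using (Unique-resp-↭)

open Defs.Translation using (⟦_⟧; ⟦_⟧⊥; ⟦_⟧L; trDual-correct; inputs; outputs)

module H = Defs.CHOP
module C = Defs.CP

dual-involutive : ∀ A → C.dual (C.dual A) ≡ A
dual-involutive (A C.⊗ B) = cong₂ C._⊗_ (dual-involutive A) (dual-involutive B)
dual-involutive (A C.⅋ B) = cong₂ C._⅋_ (dual-involutive A) (dual-involutive B)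
dual-involutive (A C.⊕ B) = cong₂ C._⊕_ (dual-involutive A) (dual-involutive B)
dual-involutive (A C.& B) = cong₂ C._&_ (dual-involutive A) (dual-involutive B)
dual-involutive C.𝟘 = refl
dual-involutive C.⊤ = refl
dual-involutive C.𝟙 = refl
dual-involutive C.⊥ = refl
dual-involutive (C.¿ A) = cong C.¿_ (dual-involutive A)
dual-involutive (C.! A) = cong C.!_ (dual-involutive A)
dual-involutive (C.∃ᵗ A) = cong C.∃ᵗ (dual-involutive A)
dual-involutive (C.∀ᵗ A) = cong C.∀ᵗ (dual-involutive A)
dual-involutive (C.var n) = refl
dual-involutive (C.dvar n) = refl

tr⊥-dual : ∀ A → ⟦ A ⟧⊥ ≡ C.dual ⟦ A ⟧
tr⊥-dual (A H.⊗ B) = cong₂ C._⅋_ (tr⊥-dual A) (tr⊥-dual B)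
tr⊥-dual (A H.⅋ B) = cong₂ C._⊗_ (tr⊥-dual A) (tr⊥-dual B)
tr⊥-dual (A H.⊕ B) = cong₂ C._&_ (tr⊥-dual A) (tr⊥-dual B)
tr⊥-dual (A H.& B) = cong₂ C._⊕_ (tr⊥-dual A) (tr⊥-dual B)
tr⊥-dual H.𝟘 = refl
tr⊥-dual H.⊤ = refl
tr⊥-dual H.𝟙 = refl
tr⊥-dual H.⊥ = refl
tr⊥-dual (H.¿ A) = cong C.!_ (tr⊥-dual A)
tr⊥-dual (H.! A) = cong C.¿_ (tr⊥-dual A)
tr⊥-dual (H.∃ᵗ A) = cong C.∀ᵗ (tr⊥-dual A)
tr⊥-dual (H.∀ᵗ A) = cong C.∃ᵗ (tr⊥-dual A)
tr⊥-dual (H.var n) = refl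
tr⊥-dual (H.dvar n) = refl
tr⊥-dual (H.send Δ) = cong (C._⅋ C.⊥) (sym (dual-involutive ⟦ Δ ⟧L))
tr⊥-dual (H.recv Δ) = refl

dual-tr⊥ : ∀ A → C.dual ⟦ A ⟧⊥ ≡ ⟦ A ⟧
dual-tr⊥ A = trans (cong C.dual (tr⊥-dual A)) (dual-involutive ⟦ A ⟧)

tr-dual : ∀ A → ⟦ H.dual A ⟧ ≡ C.dual ⟦ A ⟧
tr-dual A = trans (sym (trDual-correct A)) (tr⊥-dual A)

tr⊥-natural : ∀ (f : C.Ty → C.Ty) → (∀ B → f (C.dual B) ≡ C.dual (f B)) →
              ∀ {A A'} → ⟦ A' ⟧ ≡ f ⟦ A ⟧ → ⟦ A' ⟧⊥ ≡ f ⟦ A ⟧⊥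
tr⊥-natural f f-dual {A} {A'} eq = begin
  ⟦ A' ⟧⊥          ≡⟨ tr⊥-dual A' ⟩
  C.dual ⟦ A' ⟧    ≡⟨ cong C.dual eq ⟩
  C.dual (f ⟦ A ⟧) ≡⟨ sym (f-dual ⟦ A ⟧) ⟩
  f (C.dual ⟦ A ⟧) ≡⟨ cong f (sym (tr⊥-dual A)) ⟩
  f ⟦ A ⟧⊥         ∎
  where open ≡-Reasoning

shift-dual : ∀ c A → C.shift c (C.dual A) ≡ C.dual (C.shift c A)
shift-dual c (A C.⊗ B) = cong₂ C._⅋_ (shift-dual c A) (shift-dual c B)
shift-dual c (A C.⅋ B) = cong₂ C._⊗_ (shift-dual c A) (shift-dual c B)
shift-dual c (A C.⊕ B) = cong₂ C._&_ (shift-dual c A) (shift-dual c B)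
shift-dual c (A C.& B) = cong₂ C._⊕_ (shift-dual c A) (shift-dual c B)
shift-dual c C.𝟘 = refl
shift-dual c C.⊤ = refl
shift-dual c C.𝟙 = refl
shift-dual c C.⊥ = refl
shift-dual c (C.¿ A) = cong C.!_ (shift-dual c A)
shift-dual c (C.! A) = cong C.¿_ (shift-dual c A)
shift-dual c (C.∃ᵗ A) = cong C.∀ᵗ (shift-dual (suc c) A)
shift-dual c (C.∀ᵗ A) = cong C.∃ᵗ (shift-dual (suc c) A)
shift-dual c (C.var n) = refl
shift-dual c (C.dvar n) = refl

tr-shift : ∀ c A → ⟦ H.shift c A ⟧ ≡ C.shift c ⟦ A ⟧
trL-shift : ∀ c Δ → ⟦ H.shiftL c Δ ⟧L ≡ C.shift c ⟦ Δ ⟧L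
tr-shift c (A H.⊗ B) = cong₂ C._⊗_ (tr-shift c A) (tr-shift c B)
tr-shift c (A H.⅋ B) = cong₂ C._⅋_ (tr-shift c A) (tr-shift c B)
tr-shift c (A H.⊕ B) = cong₂ C._⊕_ (tr-shift c A) (tr-shift c B)
tr-shift c (A H.& B) = cong₂ C._&_ (tr-shift c A) (tr-shift c B)
tr-shift c H.𝟘 = refl
tr-shift c H.⊤ = refl
tr-shift c H.𝟙 = refl
tr-shift c H.⊥ = refl
tr-shift c (H.¿ A) = cong C.¿_ (tr-shift c A)
tr-shift c (H.! A) = cong C.!_ (tr-shift c A)
tr-shift c (H.∃ᵗ A) = cong C.∃ᵗ (tr-shift (suc c) A)
tr-shift c (H.∀ᵗ A) = cong C.∀ᵗ (tr-shift (suc c) A)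
tr-shift c (H.var n) = refl
tr-shift c (H.dvar n) = refl
tr-shift c (H.send Δ) =
  cong (C._⊗ C.𝟙) (trans (cong C.dual (trL-shift c Δ)) (sym (shift-dual c ⟦ Δ ⟧L)))
tr-shift c (H.recv Δ) = cong (C._⅋ C.⊥) (trL-shift c Δ)
trL-shift c [] = refl
trL-shift c ((l , A) ∷ Δ) =
  cong₂ C._⊗_ (tr⊥-natural (C.shift c) (shift-dual c) {A} (tr-shift c A)) (trL-shift c Δ)

subst-dual : ∀ k A B → C.subst k A (C.dual B) ≡ C.dual (C.subst k A B)
subst-dual k A (B C.⊗ D) = cong₂ C._⅋_ (subst-dual k A B) (subst-dual k A D)
subst-dual k A (B C.⅋ D) = cong₂ C._⊗_ (subst-dual k A B) (subst-dual k A D)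
subst-dual k A (B C.⊕ D) = cong₂ C._&_ (subst-dual k A B) (subst-dual k A D)
subst-dual k A (B C.& D) = cong₂ C._⊕_ (subst-dual k A B) (subst-dual k A D)
subst-dual k A C.𝟘 = refl
subst-dual k A C.⊤ = refl
subst-dual k A C.𝟙 = refl
subst-dual k A C.⊥ = refl
subst-dual k A (C.¿ B) = cong C.!_ (subst-dual k A B)
subst-dual k A (C.! B) = cong C.¿_ (subst-dual k A B)
subst-dual k A (C.∃ᵗ B) = cong C.∀ᵗ (subst-dual (suc k) (C.shift 0 A) B)
subst-dual k A (C.∀ᵗ B) = cong C.∃ᵗ (subst-dual (suc k) (C.shift 0 A) B)
subst-dual k A (C.var n) with n ≡ᵇ k | k <ᵇ n
... | true  | _     = refl
... | false | true  = refl
... | false | false = refl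
subst-dual k A (C.dvar n) with n ≡ᵇ k | k <ᵇ n
... | true  | _     = sym (dual-involutive A)
... | false | true  = refl
... | false | false = refl

tr-subst : ∀ k A B → ⟦ H.subst k A B ⟧ ≡ C.subst k ⟦ A ⟧ ⟦ B ⟧
trL-subst : ∀ k A Δ → ⟦ H.substL k A Δ ⟧L ≡ C.subst k ⟦ A ⟧ ⟦ Δ ⟧L
tr-subst-binder : ∀ k A B →
  ⟦ H.subst (suc k) (H.shift 0 A) B ⟧ ≡ C.subst (suc k) (C.shift 0 ⟦ A ⟧) ⟦ B ⟧
tr-subst k A (B H.⊗ D) = cong₂ C._⊗_ (tr-subst k A B) (tr-subst k A D)
tr-subst k A (B H.⅋ D) = cong₂ C._⅋_ (tr-subst k A B) (tr-subst k A D)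
tr-subst k A (B H.⊕ D) = cong₂ C._⊕_ (tr-subst k A B) (tr-subst k A D)
tr-subst k A (B H.& D) = cong₂ C._&_ (tr-subst k A B) (tr-subst k A D)
tr-subst k A H.𝟘 = refl
tr-subst k A H.⊤ = refl
tr-subst k A H.𝟙 = refl
tr-subst k A H.⊥ = refl
tr-subst k A (H.¿ B) = cong C.¿_ (tr-subst k A B)
tr-subst k A (H.! B) = cong C.!_ (tr-subst k A B)
tr-subst k A (H.∃ᵗ B) = cong C.∃ᵗ (tr-subst-binder k A B)
tr-subst k A (H.∀ᵗ B) = cong C.∀ᵗ (tr-subst-binder k A B)
tr-subst k A (H.var n) with n ≡ᵇ k | k <ᵇ n
... | true  | _     = refl
... | false | true  = refl
... | false | false = refl
tr-subst k A (H.dvar n) with n ≡ᵇ k | k <ᵇ n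
... | true  | _     = tr-dual A
... | false | true  = refl
... | false | false = refl
tr-subst k A (H.send Δ) =
  cong (C._⊗ C.𝟙) (trans (cong C.dual (trL-subst k A Δ)) (sym (subst-dual k ⟦ A ⟧ ⟦ Δ ⟧L)))
tr-subst k A (H.recv Δ) = cong (C._⅋ C.⊥) (trL-subst k A Δ)
tr-subst-binder k A B =
  trans (tr-subst (suc k) (H.shift 0 A) B) (cong (λ T → C.subst (suc k) T ⟦ B ⟧) (tr-shift 0 A))
trL-subst k A [] = refl
trL-subst k A ((l , B) ∷ Δ) =
  cong₂ C._⊗_ (tr⊥-natural (C.subst k ⟦ A ⟧) (subst-dual k ⟦ A ⟧) {B} (tr-subst k A B)) (trL-subst k A Δ)

if-else-≡ : ∀ {A B : Set} (f : A → B) c {x y} → f y ≡ f x → f (if c then x else y) ≡ f x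
if-else-≡ f true  _  = refl
if-else-≡ f false eq = eq

-- Both renamings `ren x y` are defined through a helper `go` in an anonymous where block;
-- lambda lifting makes `go` depend on the whole renamed process W, so it cannot be named.
-- We recover it as `go W` by unification (the `with` turns W into a variable, so the
-- constraint on `go` is a pattern) and reason about `go W` uniformly in W.
module BoundNamesCP (x y : C.Ch) where
  mutual
    go : C.Proc → C.Proc → C.Proc
    go = _

    ren-unfold : ∀ a W → C.ren x y (C.inl a W) ≡ C.inl (if a C.== y then x else a) (go (C.inl a W) W)
    ren-unfold a W with C.inl a W
    ... | _ = refl

  bnd-go : ∀ W P → C.bnd (go W P) ≡ C.bnd P
  bnd-go W (C.out a b P Q) =
    cong₂ (λ s t → b ∷ s ++ t) (if-else-≡ C.bnd (b C.== y) (bnd-go W P)) (bnd-go W Q)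
  bnd-go W (C.inp a b P) = cong (b ∷_) (if-else-≡ C.bnd (b C.== y) (bnd-go W P))
  bnd-go W (C.inl a P) = bnd-go W P
  bnd-go W (C.inr a P) = bnd-go W P
  bnd-go W (C.case a P Q) = cong₂ _++_ (bnd-go W P) (bnd-go W Q)
  bnd-go W (C.wn a b P) = cong (b ∷_) (if-else-≡ C.bnd (b C.== y) (bnd-go W P))
  bnd-go W (C.oc a b P) = cong (b ∷_) (if-else-≡ C.bnd (b C.== y) (bnd-go W P))
  bnd-go W (C.outT a A P) = bnd-go W P
  bnd-go W (C.inpT a P) = bnd-go W P
  bnd-go W (C.close a) = refl
  bnd-go W (C.wait a P) = bnd-go W P
  bnd-go W (C.caseZ a) = refl
  bnd-go W (C.link a A b) = refl
  bnd-go W (C.nu a A b P Q) =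
    cong₂ (λ s t → a ∷ b ∷ s ++ t)
          (if-else-≡ C.bnd (a C.== y) (bnd-go W P)) (if-else-≡ C.bnd (b C.== y) (bnd-go W Q))

  bnd-ren : ∀ P → C.bnd (C.ren x y P) ≡ C.bnd P
  bnd-ren P = bnd-go P P

module BoundNamesCHOP (x y : Chan) where
  mutual
    go : H.Proc → H.Proc → H.Proc
    go = _

    ren-unfold : ∀ a W → H.ren x y (H.inl a W) ≡ H.inl (if a ≡ᵇ y then x else a) (go (H.inl a W) W)
    ren-unfold a W with H.inl a W
    ... | _ = refl

  bnd-go : ∀ W P → H.bnd (go W P) ≡ H.bnd P
  bnd-go W (H.out a b P Q) =
    cong₂ (λ s t → b ∷ s ++ t) (if-else-≡ H.bnd (b ≡ᵇ y) (bnd-go W P)) (bnd-go W Q)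
  bnd-go W (H.inp a b P) = cong (b ∷_) (if-else-≡ H.bnd (b ≡ᵇ y) (bnd-go W P))
  bnd-go W (H.inl a P) = bnd-go W P
  bnd-go W (H.inr a P) = bnd-go W P
  bnd-go W (H.case a P Q) = cong₂ _++_ (bnd-go W P) (bnd-go W Q)
  bnd-go W (H.wn a b P) = cong (b ∷_) (if-else-≡ H.bnd (b ≡ᵇ y) (bnd-go W P))
  bnd-go W (H.oc a b P) = cong (b ∷_) (if-else-≡ H.bnd (b ≡ᵇ y) (bnd-go W P))
  bnd-go W (H.outT a A P) = bnd-go W P
  bnd-go W (H.inpT a P) = bnd-go W P
  bnd-go W (H.outAbs a ρ P) =
    cong (H.images ρ ++_) (if-else-≡ H.bnd (H.memb y (H.images ρ)) (bnd-go W P))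
  bnd-go W (H.inpAbs a p P) = bnd-go W P
  bnd-go W (H.run p ρ) = refl
  bnd-go W (H.close a) = refl
  bnd-go W (H.wait a P) = bnd-go W P
  bnd-go W (H.caseZ a) = refl
  bnd-go W (H.link a A b) = refl
  bnd-go W (H.nu a A b P Q) =
    cong₂ (λ s t → a ∷ b ∷ s ++ t)
          (if-else-≡ H.bnd (a ≡ᵇ y) (bnd-go W P)) (if-else-≡ H.bnd (b ≡ᵇ y) (bnd-go W Q))
  bnd-go W (H.letp p ρ Q P) =
    cong₂ (λ s t → H.images ρ ++ s ++ t)
          (if-else-≡ H.bnd (H.memb y (H.images ρ)) (bnd-go W Q)) (bnd-go W P)

  bnd-ren : ∀ P → H.bnd (H.ren x y P) ≡ H.bnd P
  bnd-ren P = bnd-go P P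

bnd-contractP-CP : ∀ x y z P → C.bnd (C.contractP x y z P) ≡ C.bnd P
bnd-contractP-CP x y z P =
  trans (BoundNamesCP.bnd-ren x y (C.ren x z P)) (BoundNamesCP.bnd-ren x z P)

bnd-contractP-CHOP : ∀ x y z P → H.bnd (H.contractP x y z P) ≡ H.bnd P
bnd-contractP-CHOP x y z P =
  trans (BoundNamesCHOP.bnd-ren x y (H.ren x z P)) (BoundNamesCHOP.bnd-ren x z P)

chans : List C.Ch → List Chan
chans [] = []
chans (C.ch w ∷ l) = w ∷ chans l
chans (C.xp _ ∷ l) = chans l
chans (C.yp _ ∷ l) = chans l
chans (C.w₀ ∷ l) = chans l

chans-++ : ∀ l l' → chans (l ++ l') ≡ chans l ++ chans l'
chans-++ [] l' = refl
chans-++ (C.ch w ∷ l) l' = cong (w ∷_) (chans-++ l l')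
chans-++ (C.xp _ ∷ l) l' = chans-++ l l'
chans-++ (C.yp _ ∷ l) l' = chans-++ l l'
chans-++ (C.w₀ ∷ l) l' = chans-++ l l'

chans-++⁺ : ∀ l l' {k k'} → chans l ⊆ k → chans l' ⊆ k' → chans (l ++ l') ⊆ k ++ k'
chans-++⁺ l l' sub sub' = ⊆-trans (⊆-reflexive (chans-++ l l')) (++⁺ sub sub')

∈-chans : ∀ {w l} → C.ch w ∈ l → w ∈ chans l
∈-chans {l = C.ch _ ∷ _} (here refl) = here refl
∈-chans {l = C.ch _ ∷ _} (there m) = there (∈-chans m)
∈-chans {l = C.xp _ ∷ _} (there m) = ∈-chans m
∈-chans {l = C.yp _ ∷ _} (there m) = ∈-chans m
∈-chans {l = C.w₀ ∷ _} (there m) = ∈-chans m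

bnd-inputs : ∀ c zs T → chans (C.bnd (inputs c zs T)) ≡ zs ++ chans (C.bnd T)
bnd-inputs c [] T = refl
bnd-inputs c (z ∷ zs) T = cong (z ∷_) (bnd-inputs c zs T)

bnd-outputs : ∀ c {ρ Δ Γ} (i : H.Inst ρ Δ Γ) → chans (C.bnd (outputs c i)) ≡ []
bnd-outputs c H.nil = refl
bnd-outputs c (H.cons i) = bnd-outputs c i

bnd-tr : ∀ {Θ P Γ} (D : Θ ⊢ P ⦂ Γ) → chans (C.bnd (tr D)) ⊆ H.bnd P
bnd-inputs-tr : ∀ c ρ {Θ P Γ} (D : Θ ⊢ P ⦂ Γ) →
                chans (C.bnd (inputs c (H.images ρ) (tr D))) ⊆ H.images ρ ++ H.bnd P
bnd-tr (H.exch _ _ d) = bnd-tr d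
bnd-tr (H.ax _) ()
bnd-tr (H.cut {x = x} {y} _ d e) = ++⁺ʳ (x ∷ y ∷ []) (chans-++⁺ (C.bnd (tr d)) (C.bnd (tr e)) (bnd-tr d) (bnd-tr e))
bnd-tr (H.tensor {y = y} _ d e) = ++⁺ʳ [ y ] (chans-++⁺ (C.bnd (tr d)) (C.bnd (tr e)) (bnd-tr d) (bnd-tr e))
bnd-tr (H.par {y = y} _ d) = ++⁺ʳ [ y ] (bnd-tr d)
bnd-tr (H.plus₁ _ d) = bnd-tr d
bnd-tr (H.plus₂ _ d) = bnd-tr d
bnd-tr (H.with& _ d e) = chans-++⁺ (C.bnd (tr d)) (C.bnd (tr e)) (bnd-tr d) (bnd-tr e)
bnd-tr (H.why {y = y} _ d) = ++⁺ʳ [ y ] (bnd-tr d)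
bnd-tr (H.bang {y = y} _ _ d) = ++⁺ʳ [ y ] (bnd-tr d)
bnd-tr (H.exists _ d) = bnd-tr d
bnd-tr (H.all∀ _ d) = bnd-tr d
bnd-tr (H.weaken _ d) = bnd-tr d
bnd-tr (H.contract {P = P} {x = x} {y} {z} _ _ d) =
  subst₂ _⊆_ (cong chans (sym (bnd-contractP-CP (C.ch x) (C.ch y) (C.ch z) (tr d))))
             (sym (bnd-contractP-CHOP x y z P)) (bnd-tr d)
bnd-tr (H.one _) ()
bnd-tr (H.bot _ d) = bnd-tr d
bnd-tr (H.top _) ()
bnd-tr (H.id {p = p} _ i) = ⊆-trans (⊆-reflexive (bnd-outputs (C.xp p) i)) λ ()
bnd-tr (H.chop {P = P} {Q} {p} {ρ} _ _ d e) =
  ⊆-trans (chans-++⁺ (C.bnd (tr e)) _ (bnd-tr e) (bnd-inputs-tr (C.yp p) ρ d))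
          (⊆-reflexive-↭ (↭-trans (++-comm (H.bnd Q) _)
                                    (↭-reflexive (++-assoc (H.images ρ) (H.bnd P) (H.bnd Q)))))
bnd-tr (H.snd {ρ = ρ} _ _ d) =
  ⊆-trans (⊆-reflexive (cong chans (++-identityʳ (C.bnd (inputs C.w₀ (H.images ρ) (tr d)))))) (bnd-inputs-tr C.w₀ ρ d)
bnd-tr (H.rcv _ d) = bnd-tr d

bnd-inputs-tr c ρ d = ⊆-trans (⊆-reflexive (bnd-inputs c (H.images ρ) (tr d))) (++⁺ʳ (H.images ρ) (bnd-tr d))

Fresh : C.Ch → C.Ctx → Set
Fresh c Γ = All (c ≢_) (map proj₁ Γ)

keys-unique-resp-↭ : ∀ {K T : Set} {Γ Γ' : List (K × T)} →
                     Γ ↭ Γ' → Unique (map proj₁ Γ) → Unique (map proj₁ Γ')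
keys-unique-resp-↭ {K} π = Unique-resp-↭ (setoid K) (↭⇒↭ₛ (↭-map⁺ proj₁ π))

⊢-wf : ∀ {P Γ} → ⊢ P ⦂ Γ → C.WF Γ
⊢-wf (C.exch π d) = keys-unique-resp-↭ π (⊢-wf d)
⊢-wf (C.ax wf) = wf
⊢-wf (C.cut wf _ _) = wf
⊢-wf (C.tensor wf _ _) = wf
⊢-wf (C.par wf _) = wf
⊢-wf (C.plus₁ wf _) = wf
⊢-wf (C.plus₂ wf _) = wf
⊢-wf (C.with& wf _ _) = wf
⊢-wf (C.why wf _) = wf
⊢-wf (C.bang wf _ _) = wf
⊢-wf (C.exists wf _) = wf
⊢-wf (C.all∀ wf _) = wf
⊢-wf (C.weaken wf _) = wf
⊢-wf (C.contract wf _ _) = wf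
⊢-wf (C.one wf) = wf
⊢-wf (C.bot wf _) = wf
⊢-wf (C.top wf) = wf

keys-⟦⟧C : ∀ Γ → map proj₁ ⟦ Γ ⟧C ≡ map C.ch (map proj₁ Γ)
keys-⟦⟧C [] = refl
keys-⟦⟧C ((x , _) ∷ Γ) = cong (C.ch x ∷_) (keys-⟦⟧C Γ)

keys-⟦⟧E : ∀ Θ → map proj₁ ⟦ Θ ⟧E ≡ map C.xp (map proj₁ Θ)
keys-⟦⟧E [] = refl
keys-⟦⟧E ((p , _) ∷ Θ) = cong (C.xp p ∷_) (keys-⟦⟧E Θ)

xp-ch-disjoint : ∀ ps xs → Disjoint (map C.xp ps) (map C.ch xs)
xp-ch-disjoint ps xs (m , n) with ∈-map⁻ C.xp m | ∈-map⁻ C.ch n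
... | _ , _ , refl | _ , _ , ()

wf-⟦⟧ : ∀ Θ Γ → H.WF Θ Γ → C.WF (⟦ Θ ⟧E ++ ⟦ Γ ⟧C)
wf-⟦⟧ Θ Γ (wfΘ , wfΓ) rewrite map-++ proj₁ ⟦ Θ ⟧E ⟦ Γ ⟧C | keys-⟦⟧E Θ | keys-⟦⟧C Γ =
  Unique.++⁺ (Unique.map⁺ (λ { refl → refl }) wfΘ) (Unique.map⁺ (λ { refl → refl }) wfΓ)
             (xp-ch-disjoint (map proj₁ Θ) (map proj₁ Γ))

H-⊢-wf : ∀ {Θ P Γ} → Θ ⊢ P ⦂ Γ → H.WF Θ Γ
H-⊢-wf (H.exch πΘ πΓ d) with H-⊢-wf d
... | wfΘ , wfΓ = keys-unique-resp-↭ πΘ wfΘ , keys-unique-resp-↭ πΓ wfΓ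
H-⊢-wf (H.ax wf) = wf
H-⊢-wf (H.cut wf _ _) = wf
H-⊢-wf (H.tensor wf _ _) = wf
H-⊢-wf (H.par wf _) = wf
H-⊢-wf (H.plus₁ wf _) = wf
H-⊢-wf (H.plus₂ wf _) = wf
H-⊢-wf (H.with& wf _ _) = wf
H-⊢-wf (H.why wf _) = wf
H-⊢-wf (H.bang wf _ _) = wf
H-⊢-wf (H.exists wf _) = wf
H-⊢-wf (H.all∀ wf _) = wf
H-⊢-wf (H.weaken wf _) = wf
H-⊢-wf (H.contract wf _ _) = wf
H-⊢-wf (H.one wf) = wf
H-⊢-wf (H.bot wf _) = wf
H-⊢-wf (H.top wf) = wf
H-⊢-wf (H.id wf _) = wf
H-⊢-wf (H.chop wf _ _ _) = wf
H-⊢-wf (H.snd wf _ _) = wf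
H-⊢-wf (H.rcv wf _) = wf

wf-tr : ∀ {Θ P Γ} → Θ ⊢ P ⦂ Γ → C.WF (⟦ Θ ⟧E ++ ⟦ Γ ⟧C)
wf-tr {Θ} {Γ = Γ} D = wf-⟦⟧ Θ Γ (H-⊢-wf D)

fresh-⟦⟧E : ∀ {c} → (∀ p → c ≢ C.xp p) → ∀ Θ → Fresh c ⟦ Θ ⟧E
fresh-⟦⟧E c≢xp [] = []
fresh-⟦⟧E c≢xp ((p , _) ∷ Θ) = c≢xp p ∷ fresh-⟦⟧E c≢xp Θ

allWn-⟦⟧ : ∀ {Γ} → H.AllWn Γ → C.AllWn ⟦ Γ ⟧C
allWn-⟦⟧ [] = []
allWn-⟦⟧ ((B , refl) ∷ wn) = (⟦ B ⟧ , refl) ∷ allWn-⟦⟧ wn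

shiftE-⟦⟧ : ∀ Θ → ⟦ H.shiftE Θ ⟧E ≡ C.shiftC ⟦ Θ ⟧E
shiftE-⟦⟧ [] = refl
shiftE-⟦⟧ ((p , Δ) ∷ Θ) = cong₂ _∷_ (cong (C.xp p ,_) (trL-shift 0 Δ)) (shiftE-⟦⟧ Θ)

shiftC-⟦⟧ : ∀ Γ → ⟦ H.shiftC Γ ⟧C ≡ C.shiftC ⟦ Γ ⟧C
shiftC-⟦⟧ [] = refl
shiftC-⟦⟧ ((x , A) ∷ Γ) = cong₂ _∷_ (cong (C.ch x ,_) (tr-shift 0 A)) (shiftC-⟦⟧ Γ)

exch-wf : ∀ {P Γ Γ'} → Γ ↭ Γ' → C.WF Γ' → (C.WF Γ → ⊢ P ⦂ Γ) → ⊢ P ⦂ Γ'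
exch-wf π wf rule = C.exch π (rule (keys-unique-resp-↭ (↭-sym π) wf))

to-head : ∀ E {a G P} → ⊢ P ⦂ E ++ a ∷ G → ⊢ P ⦂ a ∷ E ++ G
to-head E = C.exch (↭-shift _ E _)

to-head₂ : ∀ E {a b G P} → ⊢ P ⦂ E ++ a ∷ b ∷ G → ⊢ P ⦂ a ∷ b ∷ E ++ G
to-head₂ E d = C.exch (prep _ (↭-shift _ E _)) (to-head E d)

at-head : ∀ E {a G P} → C.WF (E ++ a ∷ G) → (C.WF (a ∷ E ++ G) → ⊢ P ⦂ a ∷ E ++ G) →
          ⊢ P ⦂ E ++ a ∷ G
at-head E = exch-wf (↭-sym (↭-shift _ E _))

forward : ∀ z A → ⊢ C.link (C.ch z) ⟦ A ⟧⊥ C.w₀ ⦂ (C.w₀ , ⟦ A ⟧⊥) ∷ (C.ch z , ⟦ A ⟧) ∷ []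
forward z A = subst (λ B → ⊢ C.link (C.ch z) ⟦ A ⟧⊥ C.w₀ ⦂ (C.w₀ , ⟦ A ⟧⊥) ∷ (C.ch z , B) ∷ []) (dual-tr⊥ A)
                (C.exch (swap _ _ refl) (C.ax (((λ ()) ∷ []) ∷ [] ∷ [])))

outputs-typed : ∀ c {ρ Δ Γ} (i : H.Inst ρ Δ Γ) → C.WF ((c , ⟦ Δ ⟧L) ∷ ⟦ Γ ⟧C) →
                ⊢ outputs c i ⦂ (c , ⟦ Δ ⟧L) ∷ ⟦ Γ ⟧C
outputs-typed c H.nil wf = C.one wf
outputs-typed c (H.cons {x = z} {A = A} i) wf@((_ ∷ c-fresh) ∷ (_ ∷ wfΓ)) =
  C.tensor wf (forward z A) (outputs-typed c i (c-fresh ∷ wfΓ))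

inputs-typed : ∀ c → (∀ n → c ≢ C.ch n) → ∀ {ρ Δ Γ} → H.Inst ρ Δ Γ →
               ∀ {R T} → Fresh c R → ⊢ T ⦂ ⟦ Γ ⟧C ++ R →
               ⊢ inputs c (H.images ρ) T ⦂ (c , C.dual ⟦ Δ ⟧L) ∷ R
inputs-typed c c≢ch H.nil c-fresh d = C.bot (c-fresh ∷ ⊢-wf d) d
inputs-typed c c≢ch (H.cons {x = z} {A = A} {ρ = ρ} {Δ = Δ} {Γ = Γ} i) {R} {T} c-fresh d =
  C.par (Unique.drop⁺ 1 (⊢-wf body)) body
  where
  rest : ⊢ inputs c (H.images ρ) T ⦂ (c , C.dual ⟦ Δ ⟧L) ∷ (C.ch z , ⟦ A ⟧) ∷ R
  rest = inputs-typed c c≢ch i (c≢ch z ∷ c-fresh) (C.exch (↭-sym (↭-shift _ ⟦ Γ ⟧C _)) d)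
  body : ⊢ inputs c (H.images ρ) T ⦂ (C.ch z , C.dual ⟦ A ⟧⊥) ∷ (c , C.dual ⟦ Δ ⟧L) ∷ R
  body = subst (λ B → ⊢ inputs c (H.images ρ) T ⦂ (C.ch z , B) ∷ _) (sym (dual-tr⊥ A))
               (C.exch (swap _ _ refl) rest)

split-↭ : ∀ Θ Θ' Γ Δ →
          (⟦ Θ ⟧E ++ ⟦ Γ ⟧C) ++ (⟦ Θ' ⟧E ++ ⟦ Δ ⟧C) ↭ ⟦ Θ ++ Θ' ⟧E ++ ⟦ Γ ++ Δ ⟧C
split-↭ Θ Θ' Γ Δ = begin
  (E ++ G) ++ (E' ++ D) ≡⟨ ++-assoc E G (E' ++ D) ⟩
  E ++ (G ++ (E' ++ D)) ↭⟨ ↭-++⁺ˡ E (shifts G E') ⟩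
  E ++ (E' ++ (G ++ D)) ≡⟨ sym (++-assoc E E' (G ++ D)) ⟩
  (E ++ E') ++ (G ++ D) ≡⟨ sym (cong₂ _++_ (map-++ _ Θ Θ') (map-++ _ Γ Δ)) ⟩
  ⟦ Θ ++ Θ' ⟧E ++ ⟦ Γ ++ Δ ⟧C ∎
  where
  open PermutationReasoning
  E E' G D : C.Ctx
  E = ⟦ Θ ⟧E
  E' = ⟦ Θ' ⟧E
  G = ⟦ Γ ⟧C
  D = ⟦ Δ ⟧C

cut-typed : ∀ {Θ Θ' Γ Δ x y A P Q} → C.WF (⟦ Θ ++ Θ' ⟧E ++ ⟦ Γ ++ Δ ⟧C) →
            ⊢ P ⦂ ⟦ Θ ⟧E ++ (C.ch x , ⟦ A ⟧) ∷ ⟦ Γ ⟧C →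
            ⊢ Q ⦂ ⟦ Θ' ⟧E ++ (C.ch y , ⟦ H.dual A ⟧) ∷ ⟦ Δ ⟧C →
            ⊢ C.nu (C.ch x) ⟦ A ⟧ (C.ch y) P Q ⦂ ⟦ Θ ++ Θ' ⟧E ++ ⟦ Γ ++ Δ ⟧C
cut-typed {Θ} {Θ'} {Γ} {Δ} {y = y} {A} {Q = Q} wf d e =
  exch-wf (split-↭ Θ Θ' Γ Δ) wf λ wf' →
    C.cut wf' (to-head ⟦ Θ ⟧E d)
              (subst (λ B → ⊢ Q ⦂ (C.ch y , B) ∷ _) (tr-dual A) (to-head ⟦ Θ' ⟧E e))

tensor-typed : ∀ {Θ Θ' Γ Δ x y A B P Q} →
               C.WF (⟦ Θ ++ Θ' ⟧E ++ (C.ch x , ⟦ A ⟧ C.⊗ ⟦ B ⟧) ∷ ⟦ Γ ++ Δ ⟧C) →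
               ⊢ P ⦂ ⟦ Θ ⟧E ++ (C.ch y , ⟦ A ⟧) ∷ ⟦ Γ ⟧C →
               ⊢ Q ⦂ ⟦ Θ' ⟧E ++ (C.ch x , ⟦ B ⟧) ∷ ⟦ Δ ⟧C →
               ⊢ C.out (C.ch x) (C.ch y) P Q ⦂ ⟦ Θ ++ Θ' ⟧E ++ (C.ch x , ⟦ A ⟧ C.⊗ ⟦ B ⟧) ∷ ⟦ Γ ++ Δ ⟧C
tensor-typed {Θ} {Θ'} {Γ} {Δ} wf d e =
  exch-wf (↭-trans (prep _ (split-↭ Θ Θ' Γ Δ)) (↭-sym (↭-shift _ ⟦ Θ ++ Θ' ⟧E _))) wf
    λ wf' → C.tensor wf' (to-head ⟦ Θ ⟧E d) (to-head ⟦ Θ' ⟧E e)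

exists-typed : ∀ {Θ Γ x A B P} → C.WF (⟦ Θ ⟧E ++ (C.ch x , C.∃ᵗ ⟦ B ⟧) ∷ ⟦ Γ ⟧C) →
               ⊢ P ⦂ ⟦ Θ ⟧E ++ (C.ch x , ⟦ H.subst 0 A B ⟧) ∷ ⟦ Γ ⟧C →
               ⊢ C.outT (C.ch x) ⟦ A ⟧ P ⦂ ⟦ Θ ⟧E ++ (C.ch x , C.∃ᵗ ⟦ B ⟧) ∷ ⟦ Γ ⟧C
exists-typed {Θ} {x = x} {A} {B} {P} wf d =
  at-head ⟦ Θ ⟧E wf λ wf' →
    C.exists wf' (subst (λ T → ⊢ P ⦂ (C.ch x , T) ∷ _) (tr-subst 0 A B) (to-head ⟦ Θ ⟧E d))

forall-typed : ∀ {Θ Γ x B P} → C.WF (⟦ Θ ⟧E ++ (C.ch x , C.∀ᵗ ⟦ B ⟧) ∷ ⟦ Γ ⟧C) →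
            ⊢ P ⦂ ⟦ H.shiftE Θ ⟧E ++ (C.ch x , ⟦ B ⟧) ∷ ⟦ H.shiftC Γ ⟧C →
            ⊢ C.inpT (C.ch x) P ⦂ ⟦ Θ ⟧E ++ (C.ch x , C.∀ᵗ ⟦ B ⟧) ∷ ⟦ Γ ⟧C
forall-typed {Θ} {Γ} {x} {B} {P} wf d =
  at-head ⟦ Θ ⟧E wf λ wf' →
    C.all∀ wf' (subst (λ Γ' → ⊢ P ⦂ (C.ch x , ⟦ B ⟧) ∷ Γ') shift-⟦⟧ (to-head ⟦ H.shiftE Θ ⟧E d))
  where
  shift-⟦⟧ : ⟦ H.shiftE Θ ⟧E ++ ⟦ H.shiftC Γ ⟧C ≡ C.shiftC (⟦ Θ ⟧E ++ ⟦ Γ ⟧C)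
  shift-⟦⟧ = trans (cong₂ _++_ (shiftE-⟦⟧ Θ) (shiftC-⟦⟧ Γ)) (sym (map-++ _ ⟦ Θ ⟧E ⟦ Γ ⟧C))

chop-typed : ∀ {Θ Θ' ρ Δ Γ Γ' p P Q} → C.WF (⟦ Θ ++ Θ' ⟧E ++ ⟦ Γ ⟧C) → H.Inst ρ Δ Γ' →
             ⊢ P ⦂ ⟦ Θ ⟧E ++ ⟦ Γ' ⟧C → ⊢ Q ⦂ (C.xp p , ⟦ Δ ⟧L) ∷ ⟦ Θ' ⟧E ++ ⟦ Γ ⟧C →
             ⊢ C.nu (C.xp p) ⟦ Δ ⟧L (C.yp p) Q (inputs (C.yp p) (H.images ρ) P)
               ⦂ ⟦ Θ ++ Θ' ⟧E ++ ⟦ Γ ⟧C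
chop-typed {Θ} {Θ'} {Γ = Γ} {Γ'} {p} wf i d e =
  exch-wf regroup wf λ wf' →
    C.cut wf' e (inputs-typed (C.yp p) (λ _ ()) i (fresh-⟦⟧E (λ _ ()) Θ)
                              (C.exch (++-comm ⟦ Θ ⟧E ⟦ Γ' ⟧C) d))
  where
  regroup : (⟦ Θ' ⟧E ++ ⟦ Γ ⟧C) ++ ⟦ Θ ⟧E ↭ ⟦ Θ ++ Θ' ⟧E ++ ⟦ Γ ⟧C
  regroup = ↭-trans (++-comm (⟦ Θ' ⟧E ++ ⟦ Γ ⟧C) ⟦ Θ ⟧E) (↭-reflexive
              (trans (sym (++-assoc ⟦ Θ ⟧E ⟦ Θ' ⟧E ⟦ Γ ⟧C)) (cong (_++ ⟦ Γ ⟧C) (sym (map-++ _ Θ Θ')))))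

snd-typed : ∀ {Θ ρ Δ Γ' x P} → C.WF (⟦ Θ ⟧E ++ (C.ch x , C.dual ⟦ Δ ⟧L C.⊗ C.𝟙) ∷ []) →
            H.Inst ρ Δ Γ' →
            ⊢ P ⦂ ⟦ Θ ⟧E ++ ⟦ Γ' ⟧C →
            ⊢ C.out (C.ch x) C.w₀ (inputs C.w₀ (H.images ρ) P) (C.close (C.ch x))
              ⦂ ⟦ Θ ⟧E ++ (C.ch x , C.dual ⟦ Δ ⟧L C.⊗ C.𝟙) ∷ []
snd-typed {Θ} {Γ' = Γ'} wf i d =
  at-head ⟦ Θ ⟧E wf λ wf' →
    C.tensor wf' (inputs-typed C.w₀ (λ _ ()) i (fresh-⟦⟧E (λ _ ()) Θ)
                               (C.exch (++-comm ⟦ Θ ⟧E ⟦ Γ' ⟧C) d))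
                 (C.one ([] ∷ []))

rcv-typed : ∀ {Θ Γ Δ x p P} → C.WF (⟦ Θ ⟧E ++ (C.ch x , ⟦ Δ ⟧L C.⅋ C.⊥) ∷ ⟦ Γ ⟧C) →
            ⊢ P ⦂ (C.xp p , ⟦ Δ ⟧L) ∷ ⟦ Θ ⟧E ++ ⟦ Γ ⟧C →
            ⊢ C.inp (C.ch x) (C.xp p) (C.wait (C.ch x) P) ⦂ ⟦ Θ ⟧E ++ (C.ch x , ⟦ Δ ⟧L C.⅋ C.⊥) ∷ ⟦ Γ ⟧C
rcv-typed {Θ} wf d =
  at-head ⟦ Θ ⟧E wf λ { wf'@(x-fresh ∷ _) →
    C.par wf' (C.exch (swap _ _ refl) (C.bot (((λ ()) ∷ x-fresh) ∷ ⊢-wf d) d)) }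

ax-typed : ∀ {x y A} → C.WF ((C.ch x , C.dual ⟦ A ⟧) ∷ (C.ch y , ⟦ A ⟧) ∷ []) →
           ⊢ C.link (C.ch x) ⟦ A ⟧ (C.ch y) ⦂ (C.ch x , ⟦ H.dual A ⟧) ∷ (C.ch y , ⟦ A ⟧) ∷ []
ax-typed {x} {y} {A} wf =
  subst (λ B → ⊢ C.link (C.ch x) ⟦ A ⟧ (C.ch y) ⦂ (C.ch x , B) ∷ (C.ch y , ⟦ A ⟧) ∷ [])
        (sym (tr-dual A)) (C.ax wf)

theorem6p1 : ∀ {Θ P Γ} (D : Θ ⊢ P ⦂ Γ) → ⊢ tr D ⦂ ⟦ Θ ⟧E ++ ⟦ Γ ⟧C
theorem6p1 (H.exch πΘ πΓ d) = C.exch (↭-++⁺ (↭-map⁺ _ πΘ) (↭-map⁺ _ πΓ)) (theorem6p1 d)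
theorem6p1 D@(H.ax _) = ax-typed (wf-tr D)
theorem6p1 D@(H.cut _ d e) = cut-typed (wf-tr D) (theorem6p1 d) (theorem6p1 e)
theorem6p1 D@(H.tensor _ d e) = tensor-typed (wf-tr D) (theorem6p1 d) (theorem6p1 e)
theorem6p1 D@(H.par {Θ} _ d) =
  at-head ⟦ Θ ⟧E (wf-tr D) λ wf → C.par wf (to-head₂ ⟦ Θ ⟧E (theorem6p1 d))
theorem6p1 D@(H.plus₁ {Θ} _ d) =
  at-head ⟦ Θ ⟧E (wf-tr D) λ wf → C.plus₁ wf (to-head ⟦ Θ ⟧E (theorem6p1 d))
theorem6p1 D@(H.plus₂ {Θ} _ d) =
  at-head ⟦ Θ ⟧E (wf-tr D) λ wf → C.plus₂ wf (to-head ⟦ Θ ⟧E (theorem6p1 d))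
theorem6p1 D@(H.with& {Θ} _ d e) =
  at-head ⟦ Θ ⟧E (wf-tr D) λ wf →
    C.with& wf (to-head ⟦ Θ ⟧E (theorem6p1 d)) (to-head ⟦ Θ ⟧E (theorem6p1 e))
theorem6p1 D@(H.why {Θ} _ d) =
  at-head ⟦ Θ ⟧E (wf-tr D) λ wf → C.why wf (to-head ⟦ Θ ⟧E (theorem6p1 d))
theorem6p1 D@(H.bang _ wn d) = C.bang (wf-tr D) (allWn-⟦⟧ wn) (theorem6p1 d)
theorem6p1 D@(H.exists _ d) = exists-typed (wf-tr D) (theorem6p1 d)
theorem6p1 D@(H.all∀ _ d) = forall-typed (wf-tr D) (theorem6p1 d)
theorem6p1 D@(H.weaken {Θ} _ d) = at-head ⟦ Θ ⟧E (wf-tr D) λ wf → C.weaken wf (theorem6p1 d)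
theorem6p1 D@(H.contract {Θ} _ x∉P d) =
  at-head ⟦ Θ ⟧E (wf-tr D) λ wf →
    C.contract wf (λ x∈ → x∉P (bnd-tr d (∈-chans x∈))) (to-head₂ ⟦ Θ ⟧E (theorem6p1 d))
theorem6p1 D@(H.one _) = C.one (wf-tr D)
theorem6p1 D@(H.bot {Θ} _ d) = at-head ⟦ Θ ⟧E (wf-tr D) λ wf → C.bot wf (theorem6p1 d)
theorem6p1 D@(H.top {Θ} _) = at-head ⟦ Θ ⟧E (wf-tr D) C.top
theorem6p1 D@(H.id {p = p} _ i) = outputs-typed (C.xp p) i (wf-tr D)
theorem6p1 D@(H.chop _ i d e) = chop-typed (wf-tr D) i (theorem6p1 d) (theorem6p1 e)
theorem6p1 D@(H.snd _ i d) = snd-typed (wf-tr D) i (theorem6p1 d)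
theorem6p1 D@(H.rcv _ d) = rcv-typed (wf-tr D) (theorem6p1 d)
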